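{- Let $r$ be a positive integer such that $r+1$ is a prime that is not a Mersenne prime, and suppose there exist a positive integer $N$ and distinct primes $p_1,p_2$ with $\operatorname{ord}_{p_1}(r+1)=\operatorname{ord}_{p_2}(r+1)=2^N$. Put $q_0=p_2$, $q_N=p_1$, and for $1\le n\le N-1$ let $q_n$ be any prime with $\operatorname{ord}_{q_n}(r+1)=2^n$. Let $M=\prod_{i=0}^{N} q_i$, and let $A$ be the set of positive integers $x$ satisfying $x + r \equiv 0 \pmod{q_0}$ and $(r+1)^{2^{n-1}}x + r \equiv 0 \pmod{q_n}$ for all $n\in\{1,\ldots,N\}$. Let $B = b_1^{\alpha_1}b_2^{\alpha_2}\cdots b_s^{\alpha_s}$, where $b_1,\ldots,b_s$ are distinct primes, each greater than $r$ and each congruent to $1$ modulo $M$, and $\alpha_1,\ldots,\alpha_s$ are positive integers. Suppose $p>M$ is a prime belonging to $A$ such that $(r+1)^{\alpha}p$ is a Schemmel nontotient number of order $r$ for all nonnegative integers $\alpha$, and such that $p-r$ has a prime divisor $P$ that does not divide $(r+1)B$. Then $(r+1)^{\alpha}Bp$ is a Schemmel nontotient number of order $r$ for all nonnegative integers $\alpha$.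
   Context: For a positive integer $r$, the Schemmel totient function $S_r$ is the multiplicative arithmetic function determined by $S_r(p^{\alpha}) = 0$ if $p \le r$ and $S_r(p^{\alpha}) = p^{\alpha-1}(p-r)$ if $p > r$, for all primes $p$ and positive integers $\alpha$ (and $S_r(1)=1$). A Schemmel nontotient number of order $r$ is a positive integer not in the range of $S_r$. A Mersenne prime is a prime of the form $2^k-1$. $\operatorname{ord}_q(a)$ denotes the multiplicative order of $a$ modulo the prime $q$. -}

module Defs where

open import Data.Nat using (ℕ; zero; suc; _+_; _*_; _∸_; _^_; _≤_; _<_; _≤?_)
open import Data.Nat.DivMod using (_/_)
open import Data.Nat.Divisibility using (_∣_; _∣?_)
open import Data.Nat.Primality using (Prime; prime?)
open import Data.List using (List; map; filter; upTo)
open import Data.Nat.ListAction using (product)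
open import Relation.Binary.PropositionalEquality using (_≡_)
open import Data.Product using (Σ; _×_)
open import Relation.Nullary using (¬_; yes; no)

-- p-adic valuation of n, computed with fuel (fuel n suffices for n ≥ 1).
valF : ℕ → ℕ → ℕ → ℕ
valF zero p n = 0
valF (suc f) zero n = 0
valF (suc f) (suc zero) n = 0
valF (suc f) p@(suc (suc k)) n with p ∣? n
... | yes _ = suc (valF f p (n / p))
... | no _  = 0

val : ℕ → ℕ → ℕ
val p n = valF n p n

-- Local factor of S_r at prime p for n (1 if p ∤ n):
--   S_r(p^α) = 0 if p ≤ r, p^(α-1)(p-r) if p > r.
schemmelLocal : ℕ → ℕ → ℕ → ℕ
schemmelLocal r p n with p ∣? n
... | no _ = 1
... | yes _ with p ≤? r
...   | yes _ = 0
...   | no _  = p ^ (val p n ∸ 1) * (p ∸ r)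

primesUpTo : ℕ → List ℕ
primesUpTo n = filter prime? (upTo (suc n))

S : ℕ → ℕ → ℕ
S r n = product (map (λ p → schemmelLocal r p n) (primesUpTo n))

-- m is a Schemmel nontotient of order r: a positive integer not in the range of S_r
-- (S_r being defined on positive integers).
Nontotient : ℕ → ℕ → Set
Nontotient r m = (1 ≤ m) × ¬ (Σ ℕ λ n → (1 ≤ n) × (S r n ≡ m))

ModEq : ℕ → ℕ → ℕ → Set
ModEq m a b = Σ ℕ λ k → Σ ℕ λ l → a + k * m ≡ b + l * m

IsOrd : ℕ → ℕ → ℕ → Set
IsOrd q a k = (1 ≤ k) × ModEq q (a ^ k) 1 × ((j : ℕ) → 1 ≤ j → j < k → ¬ ModEq q (a ^ j) 1)

Mersenne : ℕ → Set
Mersenne m = Prime m × Σ ℕ λ k → m ≡ 2 ^ k ∸ 1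

{-# OPTIONS --safe #-}
module Submission where

-- Suppose S_r(n) = (r+1)^α B p. The prime p divides some local factor l^e (l − r)
-- with l > r prime. If l = p, then P ∣ p − r divides (r+1)^α B p, impossible since
-- P ∤ (r+1)^α B and P ≤ p − r < p. Otherwise l = k p + r with k ∣ (r+1)^α B, i.e.
-- k = (r+1)^c D with D ∣ B. As D ≡ 1 mod every q_i, the congruences defining A cover
-- every exponent c according to its 2-adic valuation (q_0 when 2^N ∣ c, q_(n+1) when
-- 2^n ∥ c): some q_i divides (r+1)^c D p + r = l, yet q_i < p ≤ l.

open import Defs
open import Data.Nat using (ℕ; zero; suc; _+_; _*_; _∸_; _^_; _≤_; _<_; _>_; _≟_; z≤n; s≤s; NonZero; ≢-nonZero; ≢-nonZero⁻¹; >-nonZero⁻¹; nonTrivial⇒≢1)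
open import Data.Nat.Properties
open import Data.Nat.Divisibility
open import Data.Nat.Primality using (Prime; prime?; euclidsLemma; prime⇒irreducible; prime⇒nonZero; prime⇒nonTrivial)
open import Data.Nat.Coprimality using (Coprime; coprime-divisor)
open import Data.Nat.ListAction using (product)
open import Data.Nat.ListAction.Properties using (∈⇒∣product; ∈⇒≤product; product≢0)
open import Data.Nat.Tactic.RingSolver using (solve-∀)
open import Data.Integer using (+_; _-_)
import Data.Integer as ℤ using (∣_∣)
open import Data.Integer.Divisibility using () renaming (_∣_ to _∣ℤ_)
open import Data.Integer.Properties using (m-n≡m⊖n; ⊖-≥)
open import Data.Fin using (Fin)
open import Data.List using ([]; _∷_; map; upTo; allFin)
open import Data.List.Membership.Propositional using (_∈_)
open import Data.List.Membership.Propositional.Properties using (∈-map⁺; ∈-map⁻; ∈-upTo⁺; ∈-upTo⁻; ∈-filter⁻)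
open import Data.List.Relation.Unary.All using (All; tabulate)
open import Data.List.Relation.Unary.All.Properties using () renaming (map⁺ to All-map⁺)
open import Data.List.Relation.Unary.Any using (here; there)
open import Data.Product using (∃; ∃₂; _×_; _,_; proj₁; proj₂)
open import Data.Sum using (_⊎_; inj₁; inj₂)
open import Data.Empty using (⊥-elim)
open import Function.Definitions using (Injective)
open import Relation.Binary.PropositionalEquality
open import Relation.Nullary using (¬_; yes; no; contradiction)

prime∤1 : ∀ {t} → Prime t → ¬ t ∣ 1
prime∤1 t-prime t∣1 = nonTrivial⇒≢1 {{prime⇒nonTrivial t-prime}} (∣1⇒≡1 t∣1)

prime∣prime⇒≡ : ∀ {t l} → Prime t → Prime l → t ∣ l → t ≡ l
prime∣prime⇒≡ t-prime l-prime t∣l with prime⇒irreducible l-prime t∣l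
... | inj₁ refl = ⊥-elim (prime∤1 t-prime ∣-refl)
... | inj₂ t≡l  = t≡l

prime∣^⇒∣ : ∀ {t x} → Prime t → ∀ e → t ∣ x ^ e → t ∣ x
prime∣^⇒∣ t-prime zero t∣1 = ⊥-elim (prime∤1 t-prime t∣1)
prime∣^⇒∣ {x = x} t-prime (suc e) t∣x^1+e with euclidsLemma x (x ^ e) t-prime t∣x^1+e
... | inj₁ t∣x   = t∣x
... | inj₂ t∣x^e = prime∣^⇒∣ t-prime e t∣x^e

prime∣product⇒∈ : ∀ {t} → Prime t → ∀ xs → t ∣ product xs → ∃ λ x → x ∈ xs × t ∣ x
prime∣product⇒∈ t-prime []       t∣1 = ⊥-elim (prime∤1 t-prime t∣1)
prime∣product⇒∈ t-prime (x ∷ xs) t∣x*Πxs with euclidsLemma x (product xs) t-prime t∣x*Πxs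
... | inj₁ t∣x   = x , here refl , t∣x
... | inj₂ t∣Πxs with prime∣product⇒∈ t-prime xs t∣Πxs
...   | y , y∈xs , t∣y = y , there y∈xs , t∣y

prime∤⇒coprime : ∀ {t D} → Prime t → ¬ t ∣ D → Coprime D t
prime∤⇒coprime t-prime t∤D (d∣D , d∣t) with prime⇒irreducible t-prime d∣t
... | inj₁ d≡1 = d≡1
... | inj₂ refl = ⊥-elim (t∤D d∣D)

∣prime^*⇒ : ∀ {t} → Prime t → ∀ a {Y D} → D ∣ t ^ a * Y →
  ∃₂ λ c D′ → D ≡ t ^ c * D′ × D′ ∣ Y
∣prime^*⇒ t-prime zero {Y} {D} D∣Y =
  0 , D , sym (*-identityˡ D) , subst (D ∣_) (*-identityˡ Y) D∣Y
∣prime^*⇒ {t} t-prime (suc a) {Y} {D} D∣t^1+a*Y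
  with D∣t*t^a*Y ← subst (D ∣_) (*-assoc t (t ^ a) Y) D∣t^1+a*Y
  with t ∣? D
... | no t∤D = ∣prime^*⇒ t-prime a (coprime-divisor (prime∤⇒coprime t-prime t∤D) D∣t*t^a*Y)
... | yes (divides k refl)
  with k*t∣t^a*Y*t ← subst (k * t ∣_) (*-comm t (t ^ a * Y)) D∣t*t^a*Y
  with ∣prime^*⇒ t-prime a {D = k} (*-cancelʳ-∣ t {{prime⇒nonZero t-prime}} k*t∣t^a*Y*t)
...   | c , D′ , refl , D′∣Y = suc c , D′ , t^c*D′*t≡t^1+c*D′ , D′∣Y
  where
  t^c*D′*t≡t^1+c*D′ : t ^ c * D′ * t ≡ t * t ^ c * D′
  t^c*D′*t≡t^1+c*D′ = trans (*-comm (t ^ c * D′) t) (sym (*-assoc t (t ^ c) D′))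

m∤m∸n : ∀ {m n} → 0 < n → n < m → ¬ m ∣ m ∸ n
m∤m∸n {m} {n} 0<n n<m m∣m∸n =
  <-irrefl refl (<-≤-trans (∸-monoʳ-< 0<n (<⇒≤ n<m)) (∣⇒≤ {{≢-nonZero (m>n⇒m∸n≢0 n<m)}} m∣m∸n))

∣ℤ-⇒∣∸ : ∀ {d m n} → n ≤ m → (+ d) ∣ℤ (+ m - + n) → d ∣ m ∸ n
∣ℤ-⇒∣∸ {d} {m} {n} n≤m = subst (d ∣_) (cong ℤ.∣_∣ (trans (m-n≡m⊖n m n) (⊖-≥ n≤m)))

modEq-refl : ∀ {Q a} → ModEq Q a a
modEq-refl = 0 , 0 , refl

modEq-* : ∀ {Q a b c d} → ModEq Q a b → ModEq Q c d → ModEq Q (a * c) (b * d)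
modEq-* {Q} {a} {b} {c} {d} (k , l , a+kQ≡b+lQ) (k′ , l′ , c+k′Q≡d+l′Q) =
  k * c + a * k′ + k * k′ * Q , l * d + b * l′ + l * l′ * Q , (begin
    a * c + (k * c + a * k′ + k * k′ * Q) * Q  ≡⟨ expand a c k k′ Q ⟨
    (a + k * Q) * (c + k′ * Q)                ≡⟨ cong₂ _*_ a+kQ≡b+lQ c+k′Q≡d+l′Q ⟩
    (b + l * Q) * (d + l′ * Q)                ≡⟨ expand b d l l′ Q ⟩
    b * d + (l * d + b * l′ + l * l′ * Q) * Q  ∎)
  where
  open ≡-Reasoning
  expand : ∀ x y i j Q → (x + i * Q) * (y + j * Q) ≡ x * y + (i * y + x * j + i * j * Q) * Q
  expand = solve-∀

modEq-^ : ∀ {Q y} → ModEq Q y 1 → ∀ k → ModEq Q (y ^ k) 1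
modEq-^ y≡1 zero    = modEq-refl
modEq-^ y≡1 (suc k) = modEq-* y≡1 (modEq-^ y≡1 k)

^-modEq-period : ∀ {Q a m} → ModEq Q (a ^ m) 1 → ∀ k e → ModEq Q (a ^ (m * k + e)) (a ^ e)
^-modEq-period {Q} {a} {m} aᵐ≡1 k e =
  subst₂ (ModEq Q) (sym a^[mk+e]≡[a^m]^k*a^e) (*-identityˡ (a ^ e)) (modEq-* (modEq-^ aᵐ≡1 k) modEq-refl)
  where
  a^[mk+e]≡[a^m]^k*a^e : a ^ (m * k + e) ≡ (a ^ m) ^ k * a ^ e
  a^[mk+e]≡[a^m]^k*a^e = trans (^-distribˡ-+-* a (m * k) e) (cong (_* a ^ e) (sym (^-*-assoc a m k)))

modEq-∣ : ∀ {M Q a b} → Q ∣ M → ModEq M a b → ModEq Q a b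
modEq-∣ {a = a} {b} (divides u refl) (k , l , eq) =
  k * u , l * u , subst₂ (λ x y → a + x ≡ b + y) (sym (*-assoc k u _)) (sym (*-assoc l u _)) eq

∣+-cong-modEq : ∀ {Q u v w} → ModEq Q u v → Q ∣ v + w → Q ∣ u + w
∣+-cong-modEq {Q} {u} {v} {w} (k , l , u+kQ≡v+lQ) Q∣v+w =
  ∣m+n∣m⇒∣n (subst (Q ∣_) (sym kQ+[u+w]≡lQ+[v+w]) (∣m∣n⇒∣m+n (n∣m*n l) Q∣v+w)) (n∣m*n k)
  where
  open ≡-Reasoning
  kQ+[u+w]≡lQ+[v+w] : k * Q + (u + w) ≡ l * Q + (v + w)
  kQ+[u+w]≡lQ+[v+w] = begin
    k * Q + (u + w)   ≡⟨ shuffle k u w Q ⟩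
    u + k * Q + w     ≡⟨ cong (_+ w) u+kQ≡v+lQ ⟩
    v + l * Q + w     ≡⟨ shuffle l v w Q ⟨
    l * Q + (v + w)   ∎
    where
    shuffle : ∀ i x y Q → i * Q + (x + y) ≡ x + i * Q + y
    shuffle = solve-∀

∣product-prime^⇒modEq1 : ∀ {A : Set} {Q} (f g : A → ℕ) → (∀ x → Prime (f x) × ModEq Q (f x) 1) →
  ∀ xs {D} → D ∣ product (map (λ x → f x ^ g x) xs) → ModEq Q D 1
∣product-prime^⇒modEq1 f g f-props []       D∣1 rewrite ∣1⇒≡1 D∣1 = modEq-refl
∣product-prime^⇒modEq1 f g f-props (x ∷ xs) D∣ with ∣prime^*⇒ (proj₁ (f-props x)) (g x) D∣
... | c , D′ , refl , D′∣ =
  modEq-* (modEq-^ (proj₂ (f-props x)) c) (∣product-prime^⇒modEq1 f g f-props xs D′∣)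

even⊎odd : ∀ k → (∃ λ j → k ≡ 2 * j) ⊎ (∃ λ j → k ≡ 1 + 2 * j)
even⊎odd zero = inj₁ (0 , refl)
even⊎odd (suc k) with even⊎odd k
... | inj₁ (j , refl) = inj₂ (j , refl)
... | inj₂ (j , refl) = inj₁ (suc j , sym (*-suc 2 j))

2^N∣⊎v₂<N : ∀ N c → (∃ λ k → c ≡ 2 ^ N * k) ⊎ (∃₂ λ n k → n < N × c ≡ 2 ^ suc n * k + 2 ^ n)
2^N∣⊎v₂<N zero c = inj₁ (c , sym (*-identityˡ c))
2^N∣⊎v₂<N (suc N) c with 2^N∣⊎v₂<N N c
... | inj₂ (n , k , n<N , c≡) = inj₂ (n , k , m<n⇒m<1+n n<N , c≡)
... | inj₁ (k , refl) with even⊎odd k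
...   | inj₁ (j , refl) = inj₁ (j , 2^N*[2*j]≡2^[1+N]*j)
  where
  2^N*[2*j]≡2^[1+N]*j : 2 ^ N * (2 * j) ≡ 2 * 2 ^ N * j
  2^N*[2*j]≡2^[1+N]*j = trans (sym (*-assoc (2 ^ N) 2 j)) (cong (_* j) (*-comm (2 ^ N) 2))
...   | inj₂ (j , refl) = inj₂ (N , j , ≤-refl , (begin
  2 ^ N * (1 + 2 * j)      ≡⟨ *-suc (2 ^ N) (2 * j) ⟩
  2 ^ N + 2 ^ N * (2 * j)  ≡⟨ +-comm (2 ^ N) _ ⟩
  2 ^ N * (2 * j) + 2 ^ N  ≡⟨ cong (_+ 2 ^ N) (*-assoc (2 ^ N) 2 j) ⟨
  2 ^ N * 2 * j + 2 ^ N    ≡⟨ cong (λ x → x * j + 2 ^ N) (*-comm (2 ^ N) 2) ⟩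
  2 * 2 ^ N * j + 2 ^ N    ∎))
  where open ≡-Reasoning

∣-transfer-modEq : ∀ {Q u v D x r} → ModEq Q u v → ModEq Q D 1 → Q ∣ v * x + r → Q ∣ u * D * x + r
∣-transfer-modEq {v = v} {x = x} u≡v D≡1 = ∣+-cong-modEq
  (subst (ModEq _ _) (cong (_* x) (*-identityʳ v)) (modEq-* (modEq-* u≡v D≡1) modEq-refl))

covering : ∀ {a r x N D} (q : ℕ → ℕ) →
  ModEq (q 0) (a ^ 2 ^ N) 1 →
  (∀ n → 1 ≤ n → n ≤ N → ModEq (q n) (a ^ 2 ^ n) 1) →
  q 0 ∣ x + r →
  (∀ n → 1 ≤ n → n ≤ N → q n ∣ a ^ (2 ^ (n ∸ 1)) * x + r) →
  (∀ i → i ≤ N → ModEq (q i) D 1) →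
  ∀ c → ∃ λ i → i ≤ N × q i ∣ a ^ c * D * x + r
covering {a} {r} {x} {N} q a^2^N≡1 a^2^n≡1 q₀∣x+r qₙ∣ D≡1 c with 2^N∣⊎v₂<N N c
... | inj₁ (k , refl) = 0 , z≤n , ∣-transfer-modEq a^c≡1 (D≡1 0 z≤n) q₀∣1*x+r
  where
  a^c≡1 : ModEq (q 0) (a ^ (2 ^ N * k)) 1
  a^c≡1 = subst (λ y → ModEq (q 0) y 1) (^-*-assoc a (2 ^ N) k) (modEq-^ a^2^N≡1 k)
  q₀∣1*x+r : q 0 ∣ 1 * x + r
  q₀∣1*x+r = subst (λ y → q 0 ∣ y + r) (sym (*-identityˡ x)) q₀∣x+r
... | inj₂ (n , k , n<N , refl) =
  suc n , n<N , ∣-transfer-modEq (^-modEq-period {m = 2 ^ suc n} (a^2^n≡1 (suc n) (s≤s z≤n) n<N) k (2 ^ n))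
                                 (D≡1 (suc n) n<N) (qₙ∣ (suc n) (s≤s z≤n) n<N)

≤⇒≡0⊎≡⊎interior : ∀ {i N} → i ≤ N → i ≡ 0 ⊎ i ≡ N ⊎ (1 ≤ i × i ≤ N ∸ 1)
≤⇒≡0⊎≡⊎interior {zero}  _ = inj₁ refl
≤⇒≡0⊎≡⊎interior {suc i} {suc N} (s≤s i≤N) with m≤n⇒m<n∨m≡n i≤N
... | inj₁ i<N  = inj₂ (inj₂ (s≤s z≤n , i<N))
... | inj₂ refl = inj₂ (inj₁ refl)

schemmelLocal-cases : ∀ r l n →
  schemmelLocal r l n ≡ 1 ⊎ schemmelLocal r l n ≡ 0 ⊎
  (r < l × schemmelLocal r l n ≡ l ^ (val l n ∸ 1) * (l ∸ r))
schemmelLocal-cases r l n with l ∣? n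
... | no _ = inj₁ refl
... | yes _ with l ≤? r
...   | yes _  = inj₂ (inj₁ refl)
...   | no l≰r = inj₂ (inj₂ (≰⇒> l≰r , refl))

prime∣S⇒prime∣localFactor : ∀ {r n t} → Prime t → t ∣ S r n → S r n ≢ 0 →
  ∃ λ l → Prime l × r < l × ∃ λ e → t ∣ l ^ e * (l ∸ r) × l ^ e * (l ∸ r) ∣ S r n
prime∣S⇒prime∣localFactor {r} {n} {t} t-prime t∣S S≢0 with prime∣product⇒∈ t-prime _ t∣S
... | x , x∈ , t∣x with ∈-map⁻ (λ l → schemmelLocal r l n) x∈
... | l , l∈ , refl with schemmelLocal-cases r l n
... | inj₁ ≡1 = ⊥-elim (prime∤1 t-prime (subst (t ∣_) ≡1 t∣x))
... | inj₂ (inj₁ ≡0) = ⊥-elim (S≢0 (0∣⇒≡0 (subst (_∣ S r n) ≡0 (∈⇒∣product x∈))))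
... | inj₂ (inj₂ (r<l , ≡lᵉ[l∸r])) =
  l , proj₂ (∈-filter⁻ prime? {xs = upTo (suc n)} l∈) , r<l ,
  val l n ∸ 1 , subst (t ∣_) ≡lᵉ[l∸r] t∣x , subst (_∣ S r n) ≡lᵉ[l∸r] (∈⇒∣product x∈)

p∸r∤m*p : ∀ {r p P} m → 0 < r → r < p → Prime p → Prime P → P ∣ p ∸ r → ¬ P ∣ m → ¬ p ∸ r ∣ m * p
p∸r∤m*p {r} {p} m 0<r r<p p-prime P-prime P∣p∸r P∤m p∸r∣mp with euclidsLemma m p P-prime (∣-trans P∣p∸r p∸r∣mp)
... | inj₁ P∣m = P∤m P∣m
... | inj₂ P∣p = m∤m∸n 0<r r<p (subst (_∣ p ∸ r) (prime∣prime⇒≡ P-prime p-prime P∣p) P∣p∸r)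

p∣l∸r∣m*p⇒¬prime : ∀ {r p l} m → Prime p → r < l → p ∣ l ∸ r → l ∸ r ∣ m * p →
  (∀ k → k ∣ m → ∃ λ d → Prime d × d < p × d ∣ k * p + r) → ¬ Prime l
p∣l∸r∣m*p⇒¬prime {r} {p} {l} m p-prime r<l p∣l∸r@(divides k l∸r≡kp) l∸r∣mp small-factor l-prime
  with d , d-prime , d<p , d∣kp+r ← small-factor k (*-cancelʳ-∣ p {{prime⇒nonZero p-prime}} (subst (_∣ m * p) l∸r≡kp l∸r∣mp))
  = <-irrefl d≡l (<-≤-trans d<p p≤l)
  where
  d≡l : d ≡ l
  d≡l = prime∣prime⇒≡ d-prime l-prime
          (subst (d ∣_) (trans (cong (_+ r) (sym l∸r≡kp)) (m∸n+n≡m (<⇒≤ r<l))) d∣kp+r)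
  p≤l : p ≤ l
  p≤l = ≤-trans (∣⇒≤ {{≢-nonZero (m>n⇒m∸n≢0 r<l)}} p∣l∸r) (m∸n≤m l r)

S≢m*p : ∀ {r p P} m .{{m≢0 : NonZero m}} → 0 < r → Prime p → Prime P →
  (+ P) ∣ℤ (+ p - + r) → ¬ P ∣ m →
  (∀ k → k ∣ m → ∃ λ d → Prime d × d < p × d ∣ k * p + r) →
  ∀ n → S r n ≢ m * p
S≢m*p {r} {p} m {{m≢0}} 0<r p-prime P-prime P∣p-r P∤m small-factor n Sn≡mp
  with prime∣S⇒prime∣localFactor {n = n} p-prime (subst (p ∣_) (sym Sn≡mp) (n∣m*n m))
         (subst (_≢ 0) (sym Sn≡mp) (≢-nonZero⁻¹ _ {{m*n≢0 m p {{m≢0}} {{prime⇒nonZero p-prime}}}}))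
... | l , l-prime , r<l , e , p∣lᵉ[l∸r] , lᵉ[l∸r]∣Sn
  with l∸r∣mp ← ∣-trans (n∣m*n (l ^ e)) (subst (l ^ e * (l ∸ r) ∣_) Sn≡mp lᵉ[l∸r]∣Sn)
  with l ≟ p
... | yes refl = p∸r∤m*p m 0<r r<l p-prime P-prime (∣ℤ-⇒∣∸ (<⇒≤ r<l) P∣p-r) P∤m l∸r∣mp
... | no l≢p with euclidsLemma (l ^ e) (l ∸ r) p-prime p∣lᵉ[l∸r]
...   | inj₁ p∣lᵉ  = l≢p (sym (prime∣prime⇒≡ p-prime l-prime (prime∣^⇒∣ p-prime e p∣lᵉ)))
...   | inj₂ p∣l∸r = p∣l∸r∣m*p⇒¬prime m p-prime r<l p∣l∸r l∸r∣mp small-factor l-prime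

theorem2p2 : (r : ℕ) → 1 ≤ r → Prime (suc r) → ¬ Mersenne (suc r) →
    (N : ℕ) → 1 ≤ N → (p₁ p₂ : ℕ) → Prime p₁ → Prime p₂ → p₁ ≢ p₂ →
    IsOrd p₁ (suc r) (2 ^ N) → IsOrd p₂ (suc r) (2 ^ N) →
    (q : ℕ → ℕ) → q 0 ≡ p₂ → q N ≡ p₁ →
    ((n : ℕ) → 1 ≤ n → n ≤ N ∸ 1 → Prime (q n) × IsOrd (q n) (suc r) (2 ^ n)) →
    let M = product (map q (upTo (suc N))) in
    (s : ℕ) → (b α : Fin s → ℕ) → Injective _≡_ _≡_ b →
    ((i : Fin s) → Prime (b i) × b i > r × ModEq M (b i) 1 × 1 ≤ α i) →
    let B = product (map (λ i → b i ^ α i) (allFin s)) in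
    (p : ℕ) → Prime p → p > M →
    1 ≤ p → q 0 ∣ p + r →
    ((n : ℕ) → 1 ≤ n → n ≤ N → q n ∣ suc r ^ (2 ^ (n ∸ 1)) * p + r) →
    ((a : ℕ) → Nontotient r (suc r ^ a * p)) →
    (P : ℕ) → Prime P → (+ P) ∣ℤ (+ p - + r) → ¬ (P ∣ suc r * B) →
    (a : ℕ) → Nontotient r (suc r ^ a * B * p)
theorem2p2 r 0<r r+1-prime _ N _ _ _ qN-prime q₀-prime _ ord-qN ord-q₀ q refl refl q-interior
  s b α _ b-props p p-prime p>M _ q₀∣ qₙ∣ _ P P-prime P∣p-r P∤[r+1]B a =
  >-nonZero⁻¹ (Y * p) {{m*n≢0 Y p {{Y≢0}} {{prime⇒nonZero p-prime}}}} ,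
  λ (n , _ , Sn≡Yp) → S≢m*p Y {{Y≢0}} 0<r p-prime P-prime P∣p-r P∤Y small-factor n Sn≡Yp
  where
  B : ℕ
  B = product (map (λ i → b i ^ α i) (allFin s))
  Y : ℕ
  Y = suc r ^ a * B

  q-prime : ∀ i → i ≤ N → Prime (q i)
  q-prime i i≤N with ≤⇒≡0⊎≡⊎interior i≤N
  ... | inj₁ refl                  = q₀-prime
  ... | inj₂ (inj₁ refl)           = qN-prime
  ... | inj₂ (inj₂ (1≤i , i≤N∸1)) = proj₁ (q-interior i 1≤i i≤N∸1)

  ord-qₙ : ∀ n → 1 ≤ n → n ≤ N → ModEq (q n) (suc r ^ 2 ^ n) 1
  ord-qₙ n 1≤n n≤N with ≤⇒≡0⊎≡⊎interior n≤N
  ... | inj₁ refl                  = contradiction 1≤n λ ()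
  ... | inj₂ (inj₁ refl)           = proj₁ (proj₂ ord-qN)
  ... | inj₂ (inj₂ (_ , n≤N∸1))    = proj₁ (proj₂ (proj₂ (q-interior n 1≤n n≤N∸1)))

  q∈ : ∀ i → i ≤ N → q i ∈ map q (upTo (suc N))
  q∈ i i≤N = ∈-map⁺ q (∈-upTo⁺ (s≤s i≤N))

  q<p : ∀ i → i ≤ N → q i < p
  q<p i i≤N = ≤-<-trans (∈⇒≤product qs≢0 (q∈ i i≤N)) p>M
    where
    qs≢0 : All NonZero (map q (upTo (suc N)))
    qs≢0 = All-map⁺ (tabulate λ {i} i∈ → prime⇒nonZero (q-prime i (≤-pred (∈-upTo⁻ i∈))))

  D≡1 : ∀ {D} → D ∣ B → ∀ i → i ≤ N → ModEq (q i) D 1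
  D≡1 D∣B i i≤N = ∣product-prime^⇒modEq1 b α
    (λ j → proj₁ (b-props j) , modEq-∣ (∈⇒∣product (q∈ i i≤N)) (proj₁ (proj₂ (proj₂ (b-props j))))) (allFin s) D∣B

  Y≢0 : NonZero Y
  Y≢0 = m*n≢0 (suc r ^ a) B {{m^n≢0 (suc r) a}}
    {{product≢0 (All-map⁺ {xs = allFin s} (tabulate λ {j} _ → m^n≢0 (b j) (α j) {{prime⇒nonZero (proj₁ (b-props j))}}))}}

  P∤Y : ¬ P ∣ Y
  P∤Y P∣Y with euclidsLemma (suc r ^ a) B P-prime P∣Y
  ... | inj₁ P∣[r+1]^a = P∤[r+1]B (∣m⇒∣m*n B (prime∣^⇒∣ P-prime a P∣[r+1]^a))
  ... | inj₂ P∣B       = P∤[r+1]B (∣n⇒∣m*n (suc r) P∣B)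

  small-factor : ∀ k → k ∣ Y → ∃ λ d → Prime d × d < p × d ∣ k * p + r
  small-factor k k∣Y with ∣prime^*⇒ r+1-prime a k∣Y
  ... | c , D , refl , D∣B with covering q (proj₁ (proj₂ ord-q₀)) ord-qₙ q₀∣ qₙ∣ (D≡1 D∣B) c
  ...   | i , i≤N , qᵢ∣ = q i , q-prime i i≤N , q<p i i≤N , qᵢ∣
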